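{- Let $k\ge 0$ be an integer and $n=24k+18$. Then $b_2(K_n)=n/2$.
   Context: $K_n$ is the complete graph on $n$ vertices. An odd cover of a graph $G$ is a collection of complete bipartite graphs with disjoint parts $(X,Y)$, $X,Y\subseteq V(G)$, such that each edge of $G$ is covered (one endpoint in $X$, the other in $Y$) by an odd number of them and each nonedge by an even number; $b_2(G)$ is the minimum cardinality of an odd cover of $G$. -}

module Defs where

open import Data.Nat using (ℕ; _+_; _*_; _≤_; _/_)
open import Data.Nat.DivMod using (_%_)
open import Data.Fin using (Fin)
open import Data.Bool using (Bool; true; false; _∧_; _∨_; _xor_; not)
open import Data.List using (List; []; _∷_; length)
open import Data.Product using (Σ; _×_; _,_)
open import Relation.Binary.PropositionalEquality using (_≡_; _≢_)

record Graph (n : ℕ) : Set where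
  field
    adj   : Fin n → Fin n → Bool
    sym   : ∀ u v → adj u v ≡ adj v u
    irrefl : ∀ u → adj u u ≡ false

open import Data.Fin using (_≟_)
open import Relation.Nullary.Decidable using (⌊_⌋)
open import Data.Fin.Properties using () renaming (_≟_ to _≟F_)

K : (n : ℕ) → Graph n
K n = record { adj = λ u v → not ⌊ u ≟F v ⌋ ; sym = symK ; irrefl = irrK }
  where
  open import Relation.Binary.PropositionalEquality using (refl; sym)
  open import Relation.Nullary using (yes; no)
  symK : ∀ u v → not ⌊ u ≟F v ⌋ ≡ not ⌊ v ≟F u ⌋
  symK u v with u ≟F v | v ≟F u
  ... | yes _ | yes _ = refl
  ... | no _  | no _  = refl
  ... | yes p | no q  = Data.Empty.⊥-elim (q (sym p))
    where import Data.Empty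
  ... | no p  | yes q = Data.Empty.⊥-elim (p (sym q))
    where import Data.Empty
  irrK : ∀ u → not ⌊ u ≟F u ⌋ ≡ false
  irrK u with u ≟F u
  ... | yes _ = refl
  ... | no p  = Data.Empty.⊥-elim (p refl)
    where import Data.Empty

record Biclique (n : ℕ) : Set where
  field
    X Y      : Fin n → Bool
    disjoint : ∀ v → X v ∧ Y v ≡ false

covers : ∀ {n} → Biclique n → Fin n → Fin n → Bool
covers B u v = (X u ∧ Y v) ∨ (Y u ∧ X v)
  where open Biclique B

coverParity : ∀ {n} → List (Biclique n) → Fin n → Fin n → Bool
coverParity []       u v = false
coverParity (B ∷ Bs) u v = covers B u v xor coverParity Bs u v

IsOddCover : ∀ {n} → Graph n → List (Biclique n) → Set
IsOddCover {n} G Bs = ∀ (u v : Fin n) → u ≢ v → coverParity Bs u v ≡ Graph.adj G u v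

b₂≡ : ∀ {n} → Graph n → ℕ → Set
b₂≡ {n} G m =
  Σ (List (Biclique n)) (λ Bs → IsOddCover G Bs × length Bs ≡ m)
  × (∀ (Bs : List (Biclique n)) → IsOddCover G Bs → m ≤ length Bs)

{-# OPTIONS --safe #-}
module Submission where

-- For a vertex set S and a vertex u, the parity of the number of v ∈ S for which
-- {u, v} is covered an odd number of times is the sum over the bicliques (X, Y) of
-- [u ∈ X]·|S ∩ Y| + [u ∈ Y]·|S ∩ X| (mod 2), so it only depends on the 2m parities of
-- |S ∩ X| and |S ∩ Y|. For an odd cover of K_n it equals |S| + [u ∈ S], and these n values
-- determine S when n is even. Hence the 2^n vertex sets inject into 2^(2m) parity profiles.
--
-- A vertex is labelled by the word over {O, L, R} recording, for each of the m
-- bicliques, whether it lies outside, in X or in Y; {u, v} is covered once for each position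
-- where the two words carry L and R. So one needs n words of length m that pairwise cross an
-- odd number of times. Against a block ℓ^m with m odd, a word of odd support crosses like the
-- single letter L or R given by the parity of its R's, and ℓ^m crosses like ℓ. Hence a fixed
-- gadget of 24 words of length 12 turns N such words, all of odd support and of odd length m,
-- into N + 24 such words of length m + 12; iterating from 18 words of length 9 gives
-- 24k + 18 words of length 12k + 9.

open import Defs
open import Algebra.Bundles using (CommutativeRing; CommutativeMonoid)
open import Data.Bool using (Bool; true; false; _∧_; _∨_; _xor_; not)
open import Data.Bool.Properties
  using (xor-∧-commutativeRing; xor-assoc; xor-same; xor-identityʳ; true-xor;
         ∧-identityʳ; ∧-zeroʳ; ∧-comm; ∨-comm; ∨-identityʳ; ∧-distribˡ-xor; ∧-distribʳ-xor)
  renaming (_≟_ to _≟ᵇ_)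
open import Data.Fin using (Fin; zero; suc; combine; finToFun; funToFin)
open import Data.Fin.Properties
  using (_≟_; all?; injective⇒≤; 2↔Bool; +↔⊎; funToFin-finToFin; finToFun-funToFin)
open import Data.List using (List; []; _∷_; length)
import Data.List as List
open import Data.Nat using (ℕ; _+_; _*_; _^_; _/_; _≤_; s≤s; z≤n)
open import Data.Nat.DivMod using (m*n/n≡m)
open import Data.Nat.Properties
  using (≮⇒≥; <⇒≱; ^-monoʳ-<; *-cancelʳ-≤; *-comm; *-assoc; *-distribʳ-+)
open import Data.Product using (_,_)
open import Data.Sum using (_⊎_; inj₁; inj₂)
open import Data.Vec
  using (Vec; []; _∷_; _++_; _∷ʳ_; replicate; concat; head; tail; lookup)
open import Function using (_∘_; _↣_; Inverse; Injection)
open import Function.Properties.Inverse using (Inverse⇒Injection; ↔-sym)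
open import Relation.Binary.PropositionalEquality
open import Relation.Nullary using (yes; no)
open import Relation.Nullary.Decidable
  using (Dec; ⌊_⌋; isYes≗does; dec-false; ⌊⌋-map′; from-yes; ¬?; _→-dec_)

open CommutativeRing xor-∧-commutativeRing using (semiring; +-commutativeMonoid)
open import Algebra.Properties.Semiring.Sum semiring
  using (sum; ∑-distrib-+; sum-cong-≗; sum-replicate-zero)
open import Algebra.Properties.Semiring.Mult semiring using (_×_; ×-homo-+; ×-assoc-*)
open import Algebra.Properties.CommutativeSemigroup
  (CommutativeMonoid.commutativeSemigroup +-commutativeMonoid) using (interchange)

private
  variable
    a b m n t : ℕ
    V W : Set

-- Counting Boolean functions

funToFin-cong : {g h : Fin a → Fin b} → g ≗ h → funToFin g ≡ funToFin h
funToFin-cong {a = ℕ.zero}  g≗h = refl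
funToFin-cong {a = ℕ.suc a} g≗h = cong₂ combine (g≗h zero) (funToFin-cong (g≗h ∘ suc))

funToFin-injective : {g h : Fin a → Fin b} → funToFin g ≡ funToFin h → g ≗ h
funToFin-injective {g = g} {h} eq i = begin
  g i                       ≡⟨ finToFun-funToFin g i ⟨
  finToFun (funToFin g) i   ≡⟨ cong (λ c → finToFun c i) eq ⟩
  finToFun (funToFin h) i   ≡⟨ finToFun-funToFin h i ⟩
  h i                       ∎
  where open ≡-Reasoning

finToFun-injective : {i j : Fin (b ^ a)} → finToFun {b} {a} i ≗ finToFun j → i ≡ j
finToFun-injective {b} {a} {i} {j} eq = begin
  i                              ≡⟨ funToFin-finToFin {a} i ⟨
  funToFin (finToFun {b} {a} i)  ≡⟨ funToFin-cong eq ⟩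
  funToFin (finToFun {b} {a} j)  ≡⟨ funToFin-finToFin {a} j ⟩
  j                              ∎
  where open ≡-Reasoning

≗-reflecting⇒^-≤ : ∀ {c} (f : (Fin a → Fin b) → (Fin n → Fin c)) →
                   (∀ {g h} → f g ≗ f h → g ≗ h) → b ^ a ≤ c ^ n
≗-reflecting⇒^-≤ {a} {b} f reflects =
  injective⇒≤ {f = funToFin ∘ f ∘ finToFun {b} {a}}
    (finToFun-injective ∘ reflects ∘ funToFin-injective)

≗-reflecting⇒≤ : (f : (Fin a → Bool) → (Fin n → Bool)) →
                 (∀ {S T} → f S ≗ f T → S ≗ T) → a ≤ n
≗-reflecting⇒≤ {a} {n} f reflects =
  ≮⇒≥ λ n<a → <⇒≱ (^-monoʳ-< 2 (s≤s (s≤s z≤n)) n<a) (≗-reflecting⇒^-≤ f₂ reflects₂)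
  where
  open Inverse 2↔Bool using (to; from)
  open Injection (Inverse⇒Injection 2↔Bool) using () renaming (injective to to-injective)
  open Injection (Inverse⇒Injection (↔-sym 2↔Bool)) using () renaming (injective to from-injective)
  f₂ : (Fin a → Fin 2) → (Fin n → Fin 2)
  f₂ g = from ∘ f (to ∘ g)
  reflects₂ : ∀ {g h} → f₂ g ≗ f₂ h → g ≗ h
  reflects₂ eq = to-injective ∘ reflects (from-injective ∘ eq)

-- Parity sums and odd covers of complete graphs

xor≡false⇒≡ : ∀ x y → x xor y ≡ false → x ≡ y
xor≡false⇒≡ false false _ = refl
xor≡false⇒≡ true  true  _ = refl

sum-const-even : ∀ j (c : Bool) → sum {j * 2} (λ _ → c) ≡ false
sum-const-even ℕ.zero    c = refl
sum-const-even (ℕ.suc j) c = begin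
  c xor (c xor rest)  ≡⟨ xor-assoc c c rest ⟨
  (c xor c) xor rest  ≡⟨ cong (_xor rest) (xor-same c) ⟩
  rest                ≡⟨ sum-const-even j c ⟩
  false               ∎
  where
  open ≡-Reasoning
  rest = sum {j * 2} (λ _ → c)

infix 7 _·_

_·_ : (Fin n → Bool) → (Fin n → Bool) → Bool
S · Z = sum (λ v → S v ∧ Z v)

·-zeroʳ : (S : Fin n → Bool) → S · (λ _ → false) ≡ false
·-zeroʳ {n} S = trans (sum-cong-≗ (λ v → ∧-zeroʳ (S v))) (sum-replicate-zero n)

·-distribʳ-xor : (S Z Z′ : Fin n → Bool) → S · (λ v → Z v xor Z′ v) ≡ S · Z xor S · Z′
·-distribʳ-xor S Z Z′ =
  trans (sum-cong-≗ (λ v → ∧-distribˡ-xor (S v) (Z v) (Z′ v)))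
        (∑-distrib-+ (λ v → S v ∧ Z v) (λ v → S v ∧ Z′ v))

·-distribˡ-xor : (S T Z : Fin n → Bool) → (λ v → S v xor T v) · Z ≡ S · Z xor T · Z
·-distribˡ-xor S T Z =
  trans (sum-cong-≗ (λ v → ∧-distribʳ-xor (Z v) (S v) (T v)))
        (∑-distrib-+ (λ v → S v ∧ Z v) (λ v → T v ∧ Z v))

·-δ : (S : Fin n → Bool) (u : Fin n) → S · (λ v → ⌊ u ≟ v ⌋) ≡ S u
·-δ S zero =
  trans (cong₂ _xor_ (∧-identityʳ (S zero)) (·-zeroʳ (S ∘ suc))) (xor-identityʳ (S zero))
·-δ S (suc u) = begin
  (S zero ∧ false) xor (S ∘ suc) · (λ v → ⌊ suc u ≟ suc v ⌋)
    ≡⟨ cong₂ _xor_ (∧-zeroʳ (S zero))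
                   (sum-cong-≗ (λ v → cong (S (suc v) ∧_) (⌊⌋-map′ _ _ (u ≟ v)))) ⟩
  (S ∘ suc) · (λ v → ⌊ u ≟ v ⌋)
    ≡⟨ ·-δ (S ∘ suc) u ⟩
  S (suc u) ∎
  where open ≡-Reasoning

adjK-≢ : {u v : Fin n} → u ≢ v → Graph.adj (K n) u v ≡ true
adjK-≢ {u = u} {v} u≢v = cong not (trans (isYes≗does (u ≟ v)) (dec-false (u ≟ v) u≢v))

·-adjK : (S : Fin n → Bool) (u : Fin n) → S · Graph.adj (K n) u ≡ sum S xor S u
·-adjK S u = begin
  S · (λ v → not ⌊ u ≟ v ⌋)
    ≡⟨ sum-cong-≗ (λ v → cong (S v ∧_) (true-xor _)) ⟨
  S · (λ v → true xor ⌊ u ≟ v ⌋)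
    ≡⟨ ·-distribʳ-xor S _ _ ⟩
  S · (λ _ → true) xor S · (λ v → ⌊ u ≟ v ⌋)
    ≡⟨ cong₂ _xor_ (sum-cong-≗ (∧-identityʳ ∘ S)) (·-δ S u) ⟩
  sum S xor S u ∎
  where open ≡-Reasoning

⟂-adjK⇒≗false : ∀ j (S : Fin (j * 2) → Bool) → (∀ u → S · Graph.adj (K (j * 2)) u ≡ false) →
                S ≗ (λ _ → false)
⟂-adjK⇒≗false j S S⟂ u = trans (S≗sum u) sum≡false
  where
  S≗sum : S ≗ (λ _ → sum S)
  S≗sum u = sym (xor≡false⇒≡ (sum S) (S u) (trans (sym (·-adjK S u)) (S⟂ u)))
  sum≡false : sum S ≡ false
  sum≡false = trans (sum-cong-≗ S≗sum) (sum-const-even j (sum S))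

covers-diagonal : (B : Biclique n) (u : Fin n) → covers B u u ≡ false
covers-diagonal B u = cong₂ _∨_ (disjoint u) (trans (∧-comm (Y u) (X u)) (disjoint u))
  where open Biclique B

coverParity-diagonal : (Bs : List (Biclique n)) (u : Fin n) → coverParity Bs u u ≡ false
coverParity-diagonal []       u = refl
coverParity-diagonal (B ∷ Bs) u = cong₂ _xor_ (covers-diagonal B u) (coverParity-diagonal Bs u)

coverParity-K : {Bs : List (Biclique n)} → IsOddCover (K n) Bs →
                ∀ u v → coverParity Bs u v ≡ Graph.adj (K n) u v
coverParity-K {Bs = Bs} odd u v with u ≟ v
... | yes refl = coverParity-diagonal Bs u
... | no u≢v   = trans (odd u v u≢v) (adjK-≢ u≢v)

⟂-covers : (S : Fin n → Bool) (B : Biclique n) →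
           S · Biclique.X B ≡ false → S · Biclique.Y B ≡ false → ∀ u → S · covers B u ≡ false
⟂-covers S B S⟂X S⟂Y u with Biclique.X B u | Biclique.Y B u | Biclique.disjoint B u
... | false | false | _ = ·-zeroʳ S
... | false | true  | _ = S⟂X
... | true  | false | _ =
  trans (sum-cong-≗ (λ v → cong (S v ∧_) (∨-identityʳ (Biclique.Y B v)))) S⟂Y

parts : List (Biclique n) → List (Fin n → Bool)
parts []       = []
parts (B ∷ Bs) = Biclique.X B ∷ Biclique.Y B ∷ parts Bs

length-parts : (Bs : List (Biclique n)) → length (parts Bs) ≡ length Bs * 2
length-parts []       = refl
length-parts (B ∷ Bs) = cong (ℕ.suc ∘ ℕ.suc) (length-parts Bs)

⟂-parts⇒⟂-coverParity : (S : Fin n → Bool) (Bs : List (Biclique n)) →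
                        (∀ i → S · List.lookup (parts Bs) i ≡ false) →
                        ∀ u → S · coverParity Bs u ≡ false
⟂-parts⇒⟂-coverParity S []       _  u = ·-zeroʳ S
⟂-parts⇒⟂-coverParity S (B ∷ Bs) S⟂ u =
  trans (·-distribʳ-xor S (covers B u) (coverParity Bs u))
        (cong₂ _xor_ (⟂-covers S B (S⟂ zero) (S⟂ (suc zero)) u)
                     (⟂-parts⇒⟂-coverParity S Bs (S⟂ ∘ suc ∘ suc) u))

oddCover-K-length : ∀ j (Bs : List (Biclique (j * 2))) → IsOddCover (K (j * 2)) Bs →
                    j ≤ length Bs
oddCover-K-length j Bs odd = *-cancelʳ-≤ j (length Bs) 2
  (subst (j * 2 ≤_) (length-parts Bs) (≗-reflecting⇒≤ profile profile-reflects))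
  where
  profile : (Fin (j * 2) → Bool) → (Fin (length (parts Bs)) → Bool)
  profile S i = S · List.lookup (parts Bs) i
  profile-reflects : ∀ {S T} → profile S ≗ profile T → S ≗ T
  profile-reflects {S} {T} eq u = xor≡false⇒≡ (S u) (T u) (⟂-adjK⇒≗false j Δ Δ⟂adjK u)
    where
    Δ : Fin (j * 2) → Bool
    Δ v = S v xor T v
    Δ⟂parts : ∀ i → Δ · List.lookup (parts Bs) i ≡ false
    Δ⟂parts i = trans (·-distribˡ-xor S T Z) (trans (cong (_xor T · Z) (eq i)) (xor-same (T · Z)))
      where Z = List.lookup (parts Bs) i
    Δ⟂adjK : ∀ u → Δ · Graph.adj (K (j * 2)) u ≡ false
    Δ⟂adjK u = trans (sum-cong-≗ (λ v → cong (Δ v ∧_) (sym (coverParity-K {Bs = Bs} odd u v))))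
                     (⟂-parts⇒⟂-coverParity Δ Bs Δ⟂parts u)

-- Words over {O, L, R}

data Side : Set where
  O L R : Side

isL isR occupied : Side → Bool
isL L = true
isL _ = false
isR R = true
isR _ = false
occupied O = false
occupied _ = true

crosses : Side → Side → Bool
crosses a b = (isL a ∧ isR b) ∨ (isR a ∧ isL b)

crosses-comm : ∀ a b → crosses a b ≡ crosses b a
crosses-comm a b =
  trans (∨-comm (isL a ∧ isR b) (isR a ∧ isL b))
        (cong₂ _∨_ (∧-comm (isR a) (isL b)) (∧-comm (isL a) (isR b)))

occupied≡crosses-R-xor-crosses-L : ∀ a → occupied a ≡ crosses a R xor crosses a L
occupied≡crosses-R-xor-crosses-L O = refl
occupied≡crosses-R-xor-crosses-L L = refl
occupied≡crosses-R-xor-crosses-L R = refl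

crossings : Vec Side m → Vec Side m → Bool
crossings []      []      = false
crossings (a ∷ x) (b ∷ y) = crosses a b xor crossings x y

weight : Vec Side m → Bool
weight []      = false
weight (a ∷ x) = occupied a xor weight x

crossings-comm : (x y : Vec Side m) → crossings x y ≡ crossings y x
crossings-comm []      []      = refl
crossings-comm (a ∷ x) (b ∷ y) = cong₂ _xor_ (crosses-comm a b) (crossings-comm x y)

crossings-head-tail : (x y : Vec Side (ℕ.suc m)) →
                      crossings x y ≡ crosses (head x) (head y) xor crossings (tail x) (tail y)
crossings-head-tail (a ∷ x) (b ∷ y) = refl

crossings-++ : (x x′ : Vec Side m) (y y′ : Vec Side n) →
               crossings (x ++ y) (x′ ++ y′) ≡ crossings x x′ xor crossings y y′
crossings-++ []      []       y y′ = refl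
crossings-++ (a ∷ x) (b ∷ x′) y y′ =
  trans (cong (crosses a b xor_) (crossings-++ x x′ y y′)) (sym (xor-assoc (crosses a b) _ _))

crossings-∷ʳ : (x y : Vec Side m) (a b : Side) →
               crossings (x ∷ʳ a) (y ∷ʳ b) ≡ crossings x y xor crosses a b
crossings-∷ʳ []      []      a b = xor-identityʳ (crosses a b)
crossings-∷ʳ (c ∷ x) (d ∷ y) a b =
  trans (cong (crosses c d xor_) (crossings-∷ʳ x y a b)) (sym (xor-assoc (crosses c d) _ _))

crossings-replicate : ∀ m a b → crossings (replicate m a) (replicate m b) ≡ m × crosses a b
crossings-replicate ℕ.zero    a b = refl
crossings-replicate (ℕ.suc m) a b = cong (crosses a b xor_) (crossings-replicate m a b)

crossings-replicate-O : (x : Vec Side m) → crossings (replicate m O) x ≡ false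
crossings-replicate-O []      = refl
crossings-replicate-O (a ∷ x) = crossings-replicate-O x

weight-++ : (x : Vec Side m) (y : Vec Side n) → weight (x ++ y) ≡ weight x xor weight y
weight-++ []      y = refl
weight-++ (a ∷ x) y =
  trans (cong (occupied a xor_) (weight-++ x y)) (sym (xor-assoc (occupied a) _ _))

weight-∷ʳ : (x : Vec Side m) (a : Side) → weight (x ∷ʳ a) ≡ weight x xor occupied a
weight-∷ʳ []      a = xor-identityʳ (occupied a)
weight-∷ʳ (b ∷ x) a =
  trans (cong (occupied b xor_) (weight-∷ʳ x a)) (sym (xor-assoc (occupied b) _ _))

weight-replicate : ∀ m a → weight (replicate m a) ≡ m × occupied a
weight-replicate ℕ.zero    a = refl
weight-replicate (ℕ.suc m) a = cong (occupied a xor_) (weight-replicate m a)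

weight≡crossings-R-xor-crossings-L : (x : Vec Side m) →
  weight x ≡ crossings x (replicate m R) xor crossings x (replicate m L)
weight≡crossings-R-xor-crossings-L []      = refl
weight≡crossings-R-xor-crossings-L (a ∷ x) =
  trans (cong₂ _xor_ (occupied≡crosses-R-xor-crosses-L a) (weight≡crossings-R-xor-crossings-L x))
        (interchange (crosses a R) (crosses a L) _ _)

×-odd : ∀ m → m × true ≡ true → ∀ b → m × b ≡ b
×-odd m odd b = trans (sym (×-assoc-* m true b)) (cong (_∧ b) odd)

rights : Vec Side m → Bool
rights x = crossings x (replicate _ L)

side : Bool → Side
side false = L
side true  = R

crosses-L-side : ∀ r → crosses L (side r) ≡ r
crosses-L-side false = refl
crosses-L-side true  = refl

crosses-R-side : ∀ r → crosses R (side r) ≡ not r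
crosses-R-side false = refl
crosses-R-side true  = refl

xor≡true⇒≡not : ∀ a b → a xor b ≡ true → a ≡ not b
xor≡true⇒≡not false true  _ = refl
xor≡true⇒≡not true  false _ = refl

crossings-replicate-oddWeight : (x : Vec Side m) → weight x ≡ true →
                                ∀ a → crossings (replicate m a) x ≡ crosses a (side (rights x))
crossings-replicate-oddWeight x _ O = crossings-replicate-O x
crossings-replicate-oddWeight x _ L =
  trans (crossings-comm _ x) (sym (crosses-L-side (rights x)))
crossings-replicate-oddWeight {m} x odd R = begin
  crossings (replicate m R) x
    ≡⟨ crossings-comm _ x ⟩
  crossings x (replicate m R)
    ≡⟨ xor≡true⇒≡not _ _ (trans (sym (weight≡crossings-R-xor-crossings-L x)) odd) ⟩
  not (rights x)
    ≡⟨ crosses-R-side (rights x) ⟨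
  crosses R (side (rights x)) ∎
  where open ≡-Reasoning

crossings-++-replicate-odd : m × true ≡ true → (x y : Vec Side t) (a b : Side) →
  crossings (x ++ replicate m a) (y ++ replicate m b) ≡ crossings (x ∷ʳ a) (y ∷ʳ b)
crossings-++-replicate-odd {m} odd x y a b = begin
  crossings (x ++ replicate m a) (y ++ replicate m b)
    ≡⟨ crossings-++ x y _ _ ⟩
  crossings x y xor crossings (replicate m a) (replicate m b)
    ≡⟨ cong (crossings x y xor_) (crossings-replicate m a b) ⟩
  crossings x y xor m × crosses a b
    ≡⟨ cong (crossings x y xor_) (×-odd m odd (crosses a b)) ⟩
  crossings x y xor crosses a b
    ≡⟨ crossings-∷ʳ x y a b ⟨
  crossings (x ∷ʳ a) (y ∷ʳ b) ∎
  where open ≡-Reasoning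

weight-++-replicate-odd : m × true ≡ true → (x : Vec Side t) (a : Side) →
                          weight (x ++ replicate m a) ≡ weight (x ∷ʳ a)
weight-++-replicate-odd {m} odd x a = begin
  weight (x ++ replicate m a)          ≡⟨ weight-++ x _ ⟩
  weight x xor weight (replicate m a)  ≡⟨ cong (weight x xor_) (weight-replicate m a) ⟩
  weight x xor m × occupied a          ≡⟨ cong (weight x xor_) (×-odd m odd (occupied a)) ⟩
  weight x xor occupied a              ≡⟨ weight-∷ʳ x a ⟨
  weight (x ∷ʳ a)                      ∎
  where open ≡-Reasoning

crossings-++-oddWeight : (x y : Vec Side t) (a : Side) (z : Vec Side m) → weight z ≡ true →
  crossings (x ++ replicate m a) (y ++ z) ≡ crossings (x ∷ʳ a) (y ∷ʳ side (rights z))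
crossings-++-oddWeight {m = m} x y a z odd = begin
  crossings (x ++ replicate m a) (y ++ z)
    ≡⟨ crossings-++ x y _ z ⟩
  crossings x y xor crossings (replicate m a) z
    ≡⟨ cong (crossings x y xor_) (crossings-replicate-oddWeight z odd a) ⟩
  crossings x y xor crosses a (side (rights z))
    ≡⟨ crossings-∷ʳ x y a _ ⟨
  crossings (x ∷ʳ a) (y ∷ʳ side (rights z)) ∎
  where open ≡-Reasoning

record OddCrossingCode (V : Set) (m : ℕ) : Set where
  field
    word          : V → Vec Side m
    crossings-odd : ∀ u v → u ≢ v → crossings (word u) (word v) ≡ true
    weight-odd    : ∀ u → weight (word u) ≡ true

-- In extend, the last letter label v stands for the block replicate m (label v), and side r
-- for an old word x with rights x ≡ r.
record Gadget (g t : ℕ) : Set where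
  field
    body                : Fin g → Vec Side t
    label               : Fin g → Side
    lead                : Bool → Vec Side t
    body-crossings      : ∀ v v′ → v ≢ v′ →
                          crossings (body v ∷ʳ label v) (body v′ ∷ʳ label v′) ≡ true
    body-weight         : ∀ v → weight (body v ∷ʳ label v) ≡ true
    body-lead-crossings : ∀ v r → crossings (body v ∷ʳ label v) (lead r ∷ʳ side r) ≡ true
    lead-crossings      : ∀ r r′ → crossings (lead r) (lead r′) ≡ false
    lead-weight         : ∀ r → weight (lead r) ≡ false

extend : ∀ {g} → OddCrossingCode V m → m × true ≡ true → Gadget g t →
         OddCrossingCode (Fin g ⊎ V) (t + m)
extend {V} {m} {t} {g} C m-odd G = record
  { word          = word′
  ; crossings-odd = crossings-odd′
  ; weight-odd    = weight-odd′
  }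
  where
  open OddCrossingCode C
  open Gadget G

  word′ : Fin g ⊎ V → Vec Side (t + m)
  word′ (inj₁ v) = body v ++ replicate m (label v)
  word′ (inj₂ u) = lead (rights (word u)) ++ word u

  body-word-crossings : ∀ v u → crossings (word′ (inj₁ v)) (word′ (inj₂ u)) ≡ true
  body-word-crossings v u =
    trans (crossings-++-oddWeight (body v) _ (label v) (word u) (weight-odd u))
          (body-lead-crossings v _)

  crossings-odd′ : ∀ s s′ → s ≢ s′ → crossings (word′ s) (word′ s′) ≡ true
  crossings-odd′ (inj₁ v) (inj₁ v′) v≢v′ =
    trans (crossings-++-replicate-odd m-odd (body v) (body v′) _ _)
          (body-crossings v v′ (v≢v′ ∘ cong inj₁))
  crossings-odd′ (inj₁ v) (inj₂ u) _ = body-word-crossings v u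
  crossings-odd′ (inj₂ u) (inj₁ v) _ =
    trans (crossings-comm (word′ (inj₂ u)) _) (body-word-crossings v u)
  crossings-odd′ (inj₂ u) (inj₂ u′) u≢u′ =
    trans (crossings-++ (lead _) (lead _) (word u) (word u′))
          (cong₂ _xor_ (lead-crossings _ _) (crossings-odd u u′ (u≢u′ ∘ cong inj₂)))

  weight-odd′ : ∀ s → weight (word′ s) ≡ true
  weight-odd′ (inj₁ v) =
    trans (weight-++-replicate-odd m-odd (body v) (label v)) (body-weight v)
  weight-odd′ (inj₂ u) =
    trans (weight-++ (lead _) (word u)) (cong₂ _xor_ (lead-weight _) (weight-odd u))

reindex : W ↣ V → OddCrossingCode V m → OddCrossingCode W m
reindex f C = record
  { word          = word ∘ to
  ; crossings-odd = λ u v u≢v → crossings-odd (to u) (to v) (u≢v ∘ injective)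
  ; weight-odd    = weight-odd ∘ to
  }
  where
  open OddCrossingCode C
  open Injection f

sideBiclique : (Fin n → Side) → Biclique n
sideBiclique s = record { X = isL ∘ s ; Y = isR ∘ s ; disjoint = L-R-disjoint ∘ s }
  where
  L-R-disjoint : ∀ a → isL a ∧ isR a ≡ false
  L-R-disjoint O = refl
  L-R-disjoint L = refl
  L-R-disjoint R = refl

wordBicliques : (Fin n → Vec Side m) → List (Biclique n)
wordBicliques {m = ℕ.zero}  w = []
wordBicliques {m = ℕ.suc m} w = sideBiclique (head ∘ w) ∷ wordBicliques (tail ∘ w)

length-wordBicliques : (w : Fin n → Vec Side m) → length (wordBicliques w) ≡ m
length-wordBicliques {m = ℕ.zero}  w = refl
length-wordBicliques {m = ℕ.suc m} w = cong ℕ.suc (length-wordBicliques (tail ∘ w))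

coverParity-wordBicliques : (w : Fin n → Vec Side m) (u v : Fin n) →
                            coverParity (wordBicliques w) u v ≡ crossings (w u) (w v)
coverParity-wordBicliques {m = ℕ.zero}  w u v with w u | w v
... | [] | [] = refl
coverParity-wordBicliques {m = ℕ.suc m} w u v =
  trans (cong (crosses (head (w u)) (head (w v)) xor_) (coverParity-wordBicliques (tail ∘ w) u v))
        (sym (crossings-head-tail (w u) (w v)))

wordBicliques-isOddCover : (C : OddCrossingCode (Fin n) m) →
                           IsOddCover (K n) (wordBicliques (OddCrossingCode.word C))
wordBicliques-isOddCover C u v u≢v =
  trans (coverParity-wordBicliques word u v) (trans (crossings-odd u v u≢v) (sym (adjK-≢ u≢v)))
  where open OddCrossingCode C

-- The explicit codes

baseWords : Vec (Vec Side 9) 18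
baseWords =
    (L ∷ L ∷ L ∷ L ∷ L ∷ O ∷ O ∷ O ∷ O ∷ [])
  ∷ (O ∷ O ∷ O ∷ L ∷ R ∷ O ∷ L ∷ L ∷ L ∷ [])
  ∷ (O ∷ O ∷ O ∷ L ∷ R ∷ L ∷ O ∷ L ∷ R ∷ [])
  ∷ (O ∷ O ∷ O ∷ L ∷ R ∷ R ∷ R ∷ L ∷ O ∷ [])
  ∷ (O ∷ L ∷ R ∷ O ∷ O ∷ L ∷ R ∷ O ∷ L ∷ [])
  ∷ (L ∷ O ∷ R ∷ O ∷ O ∷ R ∷ L ∷ O ∷ R ∷ [])
  ∷ (L ∷ L ∷ L ∷ O ∷ R ∷ O ∷ O ∷ R ∷ O ∷ [])
  ∷ (L ∷ L ∷ L ∷ R ∷ O ∷ O ∷ O ∷ L ∷ O ∷ [])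
  ∷ (L ∷ R ∷ O ∷ O ∷ O ∷ L ∷ R ∷ O ∷ L ∷ [])
  ∷ (R ∷ R ∷ R ∷ R ∷ R ∷ O ∷ O ∷ O ∷ O ∷ [])
  ∷ (O ∷ O ∷ O ∷ R ∷ L ∷ O ∷ R ∷ R ∷ R ∷ [])
  ∷ (O ∷ O ∷ O ∷ R ∷ L ∷ R ∷ O ∷ R ∷ L ∷ [])
  ∷ (O ∷ O ∷ O ∷ R ∷ L ∷ L ∷ L ∷ R ∷ O ∷ [])
  ∷ (O ∷ R ∷ L ∷ O ∷ O ∷ R ∷ L ∷ O ∷ R ∷ [])
  ∷ (R ∷ O ∷ L ∷ O ∷ O ∷ L ∷ R ∷ O ∷ L ∷ [])
  ∷ (R ∷ R ∷ R ∷ O ∷ L ∷ O ∷ O ∷ L ∷ O ∷ [])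
  ∷ (R ∷ R ∷ R ∷ L ∷ O ∷ O ∷ O ∷ R ∷ O ∷ [])
  ∷ (R ∷ L ∷ O ∷ O ∷ O ∷ R ∷ L ∷ O ∷ R ∷ [])
  ∷ []

gadgetBodies : Vec (Vec Side 12) 24
gadgetBodies =
    (L ∷ L ∷ L ∷ O ∷ O ∷ O ∷ L ∷ L ∷ L ∷ R ∷ R ∷ R ∷ [])
  ∷ (L ∷ R ∷ O ∷ O ∷ L ∷ R ∷ L ∷ R ∷ O ∷ R ∷ O ∷ L ∷ [])
  ∷ (L ∷ O ∷ R ∷ O ∷ R ∷ L ∷ L ∷ O ∷ R ∷ R ∷ L ∷ O ∷ [])
  ∷ (R ∷ R ∷ R ∷ O ∷ O ∷ O ∷ R ∷ R ∷ R ∷ L ∷ L ∷ L ∷ [])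
  ∷ (R ∷ O ∷ L ∷ O ∷ L ∷ R ∷ R ∷ O ∷ L ∷ L ∷ R ∷ O ∷ [])
  ∷ (R ∷ L ∷ O ∷ O ∷ R ∷ L ∷ R ∷ L ∷ O ∷ L ∷ O ∷ R ∷ [])
  ∷ (O ∷ O ∷ O ∷ L ∷ L ∷ L ∷ L ∷ L ∷ L ∷ L ∷ L ∷ L ∷ [])
  ∷ (O ∷ L ∷ R ∷ L ∷ R ∷ O ∷ L ∷ R ∷ O ∷ L ∷ R ∷ O ∷ [])
  ∷ (O ∷ R ∷ L ∷ L ∷ O ∷ R ∷ L ∷ O ∷ R ∷ L ∷ O ∷ R ∷ [])
  ∷ (L ∷ L ∷ L ∷ L ∷ L ∷ L ∷ R ∷ R ∷ R ∷ O ∷ O ∷ O ∷ [])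
  ∷ (L ∷ R ∷ O ∷ L ∷ R ∷ O ∷ R ∷ O ∷ L ∷ O ∷ L ∷ R ∷ [])
  ∷ (L ∷ O ∷ R ∷ L ∷ O ∷ R ∷ R ∷ L ∷ O ∷ O ∷ R ∷ L ∷ [])
  ∷ (R ∷ R ∷ R ∷ L ∷ L ∷ L ∷ O ∷ O ∷ O ∷ R ∷ R ∷ R ∷ [])
  ∷ (R ∷ O ∷ L ∷ L ∷ R ∷ O ∷ O ∷ L ∷ R ∷ R ∷ O ∷ L ∷ [])
  ∷ (R ∷ L ∷ O ∷ L ∷ O ∷ R ∷ O ∷ R ∷ L ∷ R ∷ L ∷ O ∷ [])
  ∷ (O ∷ O ∷ O ∷ R ∷ R ∷ R ∷ R ∷ R ∷ R ∷ R ∷ R ∷ R ∷ [])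
  ∷ (O ∷ L ∷ R ∷ R ∷ O ∷ L ∷ R ∷ O ∷ L ∷ R ∷ O ∷ L ∷ [])
  ∷ (O ∷ R ∷ L ∷ R ∷ L ∷ O ∷ R ∷ L ∷ O ∷ R ∷ L ∷ O ∷ [])
  ∷ (L ∷ L ∷ L ∷ R ∷ R ∷ R ∷ O ∷ O ∷ O ∷ L ∷ L ∷ L ∷ [])
  ∷ (L ∷ R ∷ O ∷ R ∷ O ∷ L ∷ O ∷ L ∷ R ∷ L ∷ R ∷ O ∷ [])
  ∷ (L ∷ O ∷ R ∷ R ∷ L ∷ O ∷ O ∷ R ∷ L ∷ L ∷ O ∷ R ∷ [])
  ∷ (R ∷ R ∷ R ∷ R ∷ R ∷ R ∷ L ∷ L ∷ L ∷ O ∷ O ∷ O ∷ [])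
  ∷ (R ∷ O ∷ L ∷ R ∷ O ∷ L ∷ L ∷ R ∷ O ∷ O ∷ L ∷ R ∷ [])
  ∷ (R ∷ L ∷ O ∷ R ∷ L ∷ O ∷ L ∷ O ∷ R ∷ O ∷ R ∷ L ∷ [])
  ∷ []

gadgetLabels : Vec Side 24
gadgetLabels = concat (replicate 8 (O ∷ L ∷ R ∷ []))

gadgetLead : Bool → Vec Side 12
gadgetLead false = concat (replicate 4 (O ∷ L ∷ R ∷ []))
gadgetLead true  = concat (replicate 4 (O ∷ R ∷ L ∷ []))

∀-distinct? : {P : Fin n → Fin n → Set} → (∀ u v → Dec (P u v)) → Dec (∀ u v → u ≢ v → P u v)
∀-distinct? P? = all? λ u → all? λ v → ¬? (u ≟ v) →-dec P? u v

base : OddCrossingCode (Fin 18) 9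
base = record
  { word          = w
  ; crossings-odd = from-yes (∀-distinct? λ u v → crossings (w u) (w v) ≟ᵇ true)
  ; weight-odd    = from-yes (all? λ u → weight (w u) ≟ᵇ true)
  }
  where
  w = lookup baseWords

gadget : Gadget 24 12
gadget = record
  { body                = body
  ; label               = label
  ; lead                = gadgetLead
  ; body-crossings      = from-yes (∀-distinct? λ v v′ →
                            crossings (body v ∷ʳ label v) (body v′ ∷ʳ label v′) ≟ᵇ true)
  ; body-weight         = from-yes (all? λ v → weight (body v ∷ʳ label v) ≟ᵇ true)
  ; body-lead-crossings = body-lead-crossings
  ; lead-crossings      = λ { false false → refl ; false true → refl
                            ; true false → refl ; true true → refl }
  ; lead-weight         = λ { false → refl ; true → refl }
  }
  where
  body  = lookup gadgetBodies
  label = lookup gadgetLabels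
  body-lead-crossings : ∀ v r → crossings (body v ∷ʳ label v) (gadgetLead r ∷ʳ side r) ≡ true
  body-lead-crossings v false =
    from-yes (all? λ v → crossings (body v ∷ʳ label v) (gadgetLead false ∷ʳ L) ≟ᵇ true) v
  body-lead-crossings v true  =
    from-yes (all? λ v → crossings (body v ∷ʳ label v) (gadgetLead true ∷ʳ R) ≟ᵇ true) v

k*12+9-odd : ∀ k → (k * 12 + 9) × true ≡ true
k*12+9-odd ℕ.zero    = refl
k*12+9-odd (ℕ.suc k) = trans (×-homo-+ true 12 (k * 12 + 9)) (k*12+9-odd k)

iteratedCode : ∀ k → OddCrossingCode (Fin (k * 24 + 18)) (k * 12 + 9)
iteratedCode ℕ.zero    = base
iteratedCode (ℕ.suc k) =
  reindex (Inverse⇒Injection +↔⊎) (extend (iteratedCode k) (k*12+9-odd k) gadget)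

b₂-K-half : ∀ {n j} → n ≡ j * 2 → OddCrossingCode (Fin n) j → b₂≡ (K n) (n / 2)
b₂-K-half {j = j} refl C = subst (b₂≡ (K (j * 2))) (sym (m*n/n≡m j 2))
  ((wordBicliques word , wordBicliques-isOddCover C , length-wordBicliques word) ,
   oddCover-K-length j)
  where open OddCrossingCode C

theorem18 : ∀ (k : ℕ) → b₂≡ (K (24 * k + 18)) ((24 * k + 18) / 2)
theorem18 k = subst (λ n → b₂≡ (K n) (n / 2)) (cong (_+ 18) (*-comm k 24))
  (b₂-K-half k*24+18≡[k*12+9]*2 (iteratedCode k))
  where
  k*24+18≡[k*12+9]*2 : k * 24 + 18 ≡ (k * 12 + 9) * 2
  k*24+18≡[k*12+9]*2 = sym (trans (*-distribʳ-+ 2 (k * 12) 9) (cong (_+ 18) (*-assoc k 12 2)))
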